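{- Let $f : \{ -1,1\}^n \to \{ -1,1\}$ be computable by a parity decision tree of depth $d$. Then $$\sum_{i=1}^n \hat{f}(i) \le \sqrt{2d}.$$
   Context: For $f:\{ -1,1\}^n\to\{ -1,1\}$ and $i\in[n]$, $\hat f(i)=\mathbf{E}_x[f(x)x_i]$ with $x$ uniform on $\{ -1,1\}^n$. A parity decision tree is a rooted full binary tree in which each internal node is labelled by a set $S\subseteq[n]$, the two edges to its children are labelled $-1$ and $1$, and each leaf is labelled by a value in $\{ -1,1\}$; an input $x$ follows, at a node labelled $S$, the edge labelled $\prod_{i\in S}x_i$. The tree computes $f$ if every input $x$ reaches a leaf labelled $f(x)$. Depth is the maximum number of internal nodes on a root-to-leaf path. -}

module Defs where

open import Data.Nat using (ℕ; zero; suc; _⊔_)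
open import Data.Bool using (Bool; true; false)
open import Data.Fin using (Fin; zero; suc)
open import Data.Vec using (Vec; []; _∷_; lookup)
open import Data.Fin.Subset using (Subset)
open import Data.Sign using (Sign) renaming (_*_ to _·_)
open import Data.Integer using (+_; -[1+_])
open import Data.Rational using (ℚ; 0ℚ; 1ℚ; ½; _+_; _*_; _/_)

-- A point of the cube {-1,1}^n; Sign.+ is 1 and Sign.- is -1.
Cube : ℕ → Set
Cube n = Vec Sign n

signℚ : Sign → ℚ
signℚ Sign.+ = 1ℚ
signℚ Sign.- = -[1+ 0 ] / 1

E : (n : ℕ) → (Cube n → ℚ) → ℚ
E zero g = g []
E (suc n) g = ½ * (E n (λ x → g (Sign.- ∷ x)) + E n (λ x → g (Sign.+ ∷ x)))

fourier1 : {n : ℕ} → (Cube n → Sign) → Fin n → ℚ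
fourier1 {n} f i = E n (λ x → signℚ (f x · lookup x i))

sumFin : (n : ℕ) → (Fin n → ℚ) → ℚ
sumFin zero g = 0ℚ
sumFin (suc n) g = g zero + sumFin n (λ i → g (suc i))

parity : {n : ℕ} → Subset n → Cube n → Sign
parity [] [] = Sign.+
parity (true ∷ S) (a ∷ x) = a · parity S x
parity (false ∷ S) (a ∷ x) = parity S x

data PDT (n : ℕ) : Set where
  leaf : Sign → PDT n
  node : Subset n → PDT n → PDT n → PDT n

eval : {n : ℕ} → PDT n → Cube n → Sign
eval (leaf b) x = b
eval (node S t₋ t₊) x with parity S x
... | Sign.- = eval t₋ x
... | Sign.+ = eval t₊ x

depth : {n : ℕ} → PDT n → ℕ
depth (leaf _) = 0
depth (node S t₋ t₊) = suc (depth t₋ ⊔ depth t₊)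

Computes : {n : ℕ} → PDT n → (Cube n → Sign) → Set
Computes {n} t f = (x : Cube n) → eval t x ≡ f x
  where open import Relation.Binary.PropositionalEquality using (_≡_)

{-# OPTIONS --safe #-}
module Submission where

-- Write L x = x₁ + ⋯ + xₙ and s = Σᵢ f̂(i) = E[f·L].  Then E[(L − s·f)²] = n − s², so it
-- suffices to show E[(L − s·f)²] ≥ n − 2d.  The leaves of the tree cut the cube into affine
-- subspaces A, each defined by at most d parity constraints, with f constant on each.  On such
-- an A, and for signed parities t₁, …, tₘ and a constant c,
--   E[(L + t₁ + ⋯ + tₘ − c)² | A] ≥ n − 2·#constraints − m,
-- by induction on n.  If a constraint involves x₁, solving it for x₁ trades that constraint
-- for one more signed parity.  Otherwise x₁ is free on A, and averaging over it splits off the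
-- square of its coefficient 1 + Σ{x₁·tᵢ : tᵢ involves x₁}, which is at least 1 − #{tᵢ involving x₁}.

open import Defs

-- ℚ's _*_ is opened only in this module, so that _*_ is ℕ's in the statement of theorem8.
module Development where

  open import Data.Bool using (true; false; _xor_)
  open import Data.Fin using (Fin; zero; suc)
  open import Data.Fin.Subset using (Subset)
  import Data.Integer as ℤ
  import Data.Integer.Properties as ℤ
  open import Data.List using (List; []; _∷_; length; map)
  open import Data.List.Properties using (length-map)
  open import Data.Nat as ℕ using (ℕ; zero; suc; _⊔_)
  import Data.Nat.Properties as ℕ
  open import Data.Nat.Tactic.RingSolver using (solve-∀)
  open import Data.Product using (_×_; _,_)
  open import Data.Rational
    using (ℚ; 0ℚ; 1ℚ; ½; _+_; _-_; -_; _*_; _≤_; _/_; toℚᵘ; NonNegative; nonNegative; nonPositive)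
  open import Data.Rational.Properties
  open import Data.Rational.Solver using (module +-*-Solver)
  import Data.Rational.Unnormalised as ℚᵘ
  import Data.Rational.Unnormalised.Properties as ℚᵘ
  open import Data.Sign as Sign using (Sign) renaming (_*_ to _·_)
  import Data.Sign.Properties as Sign
  open import Algebra.Properties.CommutativeSemigroup Sign.*-commutativeSemigroup
    using (interchange; x∙yz≈y∙xz)
  open import Data.Sum using (inj₁; inj₂)
  open import Data.Vec using ([]; _∷_; lookup; zipWith)
  open import Function using (_∘_)
  open import Relation.Binary.PropositionalEquality
    using (_≡_; refl; sym; trans; cong; cong₂; subst₂; module ≡-Reasoning)

  open +-*-Solver using (solve; _:+_; _:*_; _:-_; :-_; _:=_; con)

  square : ℚ → ℚ
  square q = q * q

  fromℕ : ℕ → ℚ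
  fromℕ zero = 0ℚ
  fromℕ (suc m) = 1ℚ + fromℕ m

  instance
    ½-nonNeg : NonNegative ½
    ½-nonNeg = _

  *-nonNeg : ∀ {p q} → 0ℚ ≤ p → 0ℚ ≤ q → 0ℚ ≤ p * q
  *-nonNeg {p} {q} 0≤p 0≤q =
    nonNegative⁻¹ _ {{nonNeg*nonNeg⇒nonNeg p {{nonNegative 0≤p}} q {{nonNegative 0≤q}}}}

  square-nonNeg : ∀ q → 0ℚ ≤ square q
  square-nonNeg q with ≤-total 0ℚ q
  ... | inj₁ 0≤q = *-nonNeg 0≤q 0≤q
  ... | inj₂ q≤0 =
    nonNegative⁻¹ _ {{nonPos*nonPos⇒nonPos q {{nonPositive q≤0}} q {{nonPositive q≤0}}}}

  fromℕ-nonNeg : ∀ m → 0ℚ ≤ fromℕ m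
  fromℕ-nonNeg zero = ≤-refl
  fromℕ-nonNeg (suc m) = +-mono-≤ (nonNegative⁻¹ 1ℚ) (fromℕ-nonNeg m)

  fromℕ-+ : ∀ a b → fromℕ (a ℕ.+ b) ≡ fromℕ a + fromℕ b
  fromℕ-+ zero b = sym (+-identityˡ (fromℕ b))
  fromℕ-+ (suc a) b = trans (cong (1ℚ +_) (fromℕ-+ a b)) (sym (+-assoc 1ℚ (fromℕ a) (fromℕ b)))

  fromℕ-mono-≤ : ∀ {a b} → a ℕ.≤ b → fromℕ a ≤ fromℕ b
  fromℕ-mono-≤ {zero} {b} _ = fromℕ-nonNeg b
  fromℕ-mono-≤ (ℕ.s≤s a≤b) = +-monoʳ-≤ 1ℚ (fromℕ-mono-≤ a≤b)

  fromℕ≡/1 : ∀ m → fromℕ m ≡ ℤ.+ m / 1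
  fromℕ≡/1 zero = refl
  fromℕ≡/1 (suc m) = toℚᵘ-injective (begin
    toℚᵘ (1ℚ + fromℕ m)             ≈⟨ toℚᵘ-homo-+ 1ℚ (fromℕ m) ⟩
    ℚᵘ.1ℚᵘ ℚᵘ.+ toℚᵘ (fromℕ m)     ≈⟨ ℚᵘ.+-congʳ ℚᵘ.1ℚᵘ (toℚᵘ-cong (fromℕ≡/1 m)) ⟩
    ℚᵘ.1ℚᵘ ℚᵘ.+ toℚᵘ (ℤ.+ m / 1)   ≈⟨ ℚᵘ.+-congʳ ℚᵘ.1ℚᵘ (toℚᵘ-fromℚᵘ (ℚᵘ.mkℚᵘ (ℤ.+ m) 0)) ⟩
    ℚᵘ.1ℚᵘ ℚᵘ.+ ℚᵘ.mkℚᵘ (ℤ.+ m) 0  ≈⟨ ℚᵘ.*≡* cross ⟩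
    ℚᵘ.mkℚᵘ (ℤ.+ suc m) 0          ≈⟨ toℚᵘ-fromℚᵘ (ℚᵘ.mkℚᵘ (ℤ.+ suc m) 0) ⟨
    toℚᵘ (ℤ.+ suc m / 1)           ∎)
    where
    open ℚᵘ.≃-Reasoning
    cross : (ℤ.+ 1 ℤ.+ ℤ.+ m ℤ.* ℤ.+ 1) ℤ.* ℤ.+ 1 ≡ ℤ.+ suc m ℤ.* ℤ.+ 1
    cross = trans (ℤ.*-identityʳ _) (trans (cong (λ k → ℤ.+ 1 ℤ.+ k) (ℤ.*-identityʳ (ℤ.+ m)))
                                           (sym (ℤ.*-identityʳ (ℤ.+ suc m))))

  E-cong : ∀ n {g h : Cube n → ℚ} → (∀ x → g x ≡ h x) → E n g ≡ E n h
  E-cong zero g≗h = g≗h []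
  E-cong (suc n) g≗h =
    cong₂ (λ a b → ½ * (a + b)) (E-cong n (g≗h ∘ (Sign.- ∷_))) (E-cong n (g≗h ∘ (Sign.+ ∷_)))

  E-+ : ∀ n (g h : Cube n → ℚ) → E n (λ x → g x + h x) ≡ E n g + E n h
  E-+ zero g h = refl
  E-+ (suc n) g h = begin
    ½ * (E n (λ x → g (Sign.- ∷ x) + h (Sign.- ∷ x)) + E n (λ x → g (Sign.+ ∷ x) + h (Sign.+ ∷ x)))
      ≡⟨ cong₂ (λ a b → ½ * (a + b)) (E-+ n (g ∘ (Sign.- ∷_)) (h ∘ (Sign.- ∷_)))
                                     (E-+ n (g ∘ (Sign.+ ∷_)) (h ∘ (Sign.+ ∷_))) ⟩
    ½ * ((g₋ + h₋) + (g₊ + h₊))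
      ≡⟨ solve 4 (λ a b c d → con ½ :* ((a :+ b) :+ (c :+ d)) := con ½ :* (a :+ c) :+ con ½ :* (b :+ d))
           refl g₋ h₋ g₊ h₊ ⟩
    ½ * (g₋ + g₊) + ½ * (h₋ + h₊) ∎
    where
    open ≡-Reasoning
    g₋ = E n (g ∘ (Sign.- ∷_))
    g₊ = E n (g ∘ (Sign.+ ∷_))
    h₋ = E n (h ∘ (Sign.- ∷_))
    h₊ = E n (h ∘ (Sign.+ ∷_))

  E-*ˡ : ∀ n c (g : Cube n → ℚ) → E n (λ x → c * g x) ≡ c * E n g
  E-*ˡ zero c g = refl
  E-*ˡ (suc n) c g = begin
    ½ * (E n (λ x → c * g (Sign.- ∷ x)) + E n (λ x → c * g (Sign.+ ∷ x)))
      ≡⟨ cong₂ (λ a b → ½ * (a + b)) (E-*ˡ n c (g ∘ (Sign.- ∷_))) (E-*ˡ n c (g ∘ (Sign.+ ∷_))) ⟩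
    ½ * (c * g₋ + c * g₊)
      ≡⟨ solve 3 (λ c a b → con ½ :* (c :* a :+ c :* b) := c :* (con ½ :* (a :+ b))) refl c g₋ g₊ ⟩
    c * (½ * (g₋ + g₊)) ∎
    where
    open ≡-Reasoning
    g₋ = E n (g ∘ (Sign.- ∷_))
    g₊ = E n (g ∘ (Sign.+ ∷_))

  E-const : ∀ n c → E n (λ _ → c) ≡ c
  E-const zero c = refl
  E-const (suc n) c = trans (cong (λ a → ½ * (a + a)) (E-const n c))
                            (solve 1 (λ c → con ½ :* (c :+ c) := c) refl c)

  E-mono-≤ : ∀ n {g h : Cube n → ℚ} → (∀ x → g x ≤ h x) → E n g ≤ E n h
  E-mono-≤ zero g≤h = g≤h []
  E-mono-≤ (suc n) g≤h = *-monoˡ-≤-nonNeg ½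
    (+-mono-≤ (E-mono-≤ n (g≤h ∘ (Sign.- ∷_))) (E-mono-≤ n (g≤h ∘ (Sign.+ ∷_))))

  E-nonNeg : ∀ n {g : Cube n → ℚ} → (∀ x → 0ℚ ≤ g x) → 0ℚ ≤ E n g
  E-nonNeg n 0≤g = ≤-trans (≤-reflexive (sym (E-const n 0ℚ))) (E-mono-≤ n 0≤g)

  E-suc : ∀ n (g : Cube (suc n) → ℚ) {h : Cube n → ℚ} →
          (∀ x → g (Sign.- ∷ x) + g (Sign.+ ∷ x) ≡ (1ℚ + 1ℚ) * h x) → E (suc n) g ≡ E n h
  E-suc n g {h} g₋+g₊≡2h = begin
    ½ * (E n (g ∘ (Sign.- ∷_)) + E n (g ∘ (Sign.+ ∷_)))  ≡⟨ cong (½ *_) (E-+ n _ _) ⟨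
    ½ * E n (λ x → g (Sign.- ∷ x) + g (Sign.+ ∷ x))     ≡⟨ cong (½ *_) (E-cong n g₋+g₊≡2h) ⟩
    ½ * E n (λ x → (1ℚ + 1ℚ) * h x)                     ≡⟨ cong (½ *_) (E-*ˡ n (1ℚ + 1ℚ) h) ⟩
    ½ * ((1ℚ + 1ℚ) * E n h)
      ≡⟨ solve 1 (λ e → con ½ :* ((con 1ℚ :+ con 1ℚ) :* e) := e) refl (E n h) ⟩
    E n h                                                ∎
    where open ≡-Reasoning

  E-sumFin : ∀ n m (g : Fin m → Cube n → ℚ) →
             sumFin m (λ i → E n (g i)) ≡ E n (λ x → sumFin m (λ i → g i x))
  E-sumFin n zero g = sym (E-const n 0ℚ)
  E-sumFin n (suc m) g = trans (cong (E n (g zero) +_) (E-sumFin n m (g ∘ suc)))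
                               (sym (E-+ n (g zero) (λ x → sumFin m (λ i → g (suc i) x))))

  signℚ-· : ∀ a b → signℚ (a · b) ≡ signℚ a * signℚ b
  signℚ-· Sign.+ Sign.+ = refl
  signℚ-· Sign.+ Sign.- = refl
  signℚ-· Sign.- Sign.+ = refl
  signℚ-· Sign.- Sign.- = refl

  signℚ² : ∀ a → signℚ a * signℚ a ≡ 1ℚ
  signℚ² a = trans (sym (signℚ-· a a)) (cong signℚ (Sign.s*s≡+ a))

  _∆_ : ∀ {n} → Subset n → Subset n → Subset n
  _∆_ = zipWith _xor_

  parity-∆ : ∀ {n} (S P : Subset n) x → parity (S ∆ P) x ≡ parity S x · parity P x
  parity-∆ [] [] [] = refl
  parity-∆ (true ∷ S) (true ∷ P) (a ∷ x) = begin
    parity (S ∆ P) x                      ≡⟨ parity-∆ S P x ⟩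
    parity S x · parity P x               ≡⟨ cong (_· (parity S x · parity P x)) (Sign.s*s≡+ a) ⟨
    (a · a) · (parity S x · parity P x)   ≡⟨ interchange a (parity S x) a (parity P x) ⟨
    (a · parity S x) · (a · parity P x)   ∎
    where open ≡-Reasoning
  parity-∆ (true ∷ S) (false ∷ P) (a ∷ x) =
    trans (cong (a ·_) (parity-∆ S P x)) (sym (Sign.*-assoc a (parity S x) (parity P x)))
  parity-∆ (false ∷ S) (true ∷ P) (a ∷ x) =
    trans (cong (a ·_) (parity-∆ S P x)) (x∙yz≈y∙xz a (parity S x) (parity P x))
  parity-∆ (false ∷ S) (false ∷ P) (a ∷ x) = parity-∆ S P x

  coordinateSum : ∀ {n} → Cube n → ℚ
  coordinateSum [] = 0ℚ
  coordinateSum (a ∷ x) = signℚ a + coordinateSum x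

  sumFin-lookup : ∀ {n} a (x : Cube n) →
                  sumFin n (λ i → signℚ (a · lookup x i)) ≡ signℚ a * coordinateSum x
  sumFin-lookup a [] = sym (*-zeroʳ (signℚ a))
  sumFin-lookup a (b ∷ x) = begin
    signℚ (a · b) + sumFin _ (λ i → signℚ (a · lookup x i))
      ≡⟨ cong₂ _+_ (signℚ-· a b) (sumFin-lookup a x) ⟩
    signℚ a * signℚ b + signℚ a * coordinateSum x
      ≡⟨ *-distribˡ-+ (signℚ a) (signℚ b) (coordinateSum x) ⟨
    signℚ a * (signℚ b + coordinateSum x) ∎
    where open ≡-Reasoning

  sumFin-fourier1 : ∀ n (f : Cube n → Sign) →
                    sumFin n (fourier1 f) ≡ E n (λ x → signℚ (f x) * coordinateSum x)
  sumFin-fourier1 n f = trans (E-sumFin n n (λ i x → signℚ (f x · lookup x i)))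
                              (E-cong n (λ x → sumFin-lookup (f x) x))

  E-coordinateSum² : ∀ n → E n (square ∘ coordinateSum) ≡ fromℕ n
  E-coordinateSum² zero = refl
  E-coordinateSum² (suc n) = begin
    E (suc n) (square ∘ coordinateSum)
      ≡⟨ E-suc n (square ∘ coordinateSum) (parallelogram ∘ coordinateSum) ⟩
    E n (λ x → square (coordinateSum x) + 1ℚ)       ≡⟨ E-+ n _ _ ⟩
    E n (square ∘ coordinateSum) + E n (λ _ → 1ℚ)   ≡⟨ cong₂ _+_ (E-coordinateSum² n) (E-const n 1ℚ) ⟩
    fromℕ n + 1ℚ                                    ≡⟨ +-comm (fromℕ n) 1ℚ ⟩
    1ℚ + fromℕ n                                    ∎
    where
    open ≡-Reasoning
    parallelogram : ∀ l → square (- 1ℚ + l) + square (1ℚ + l) ≡ (1ℚ + 1ℚ) * (square l + 1ℚ)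
    parallelogram = solve 1 (λ l → (:- con 1ℚ :+ l) :* (:- con 1ℚ :+ l) :+ (con 1ℚ :+ l) :* (con 1ℚ :+ l)
                                   := (con 1ℚ :+ con 1ℚ) :* (l :* l :+ con 1ℚ)) refl

  SignedParity : ℕ → Set
  SignedParity n = Subset n × Sign

  ⟦_⟧ : ∀ {n} → SignedParity n → Cube n → Sign
  ⟦ S , b ⟧ x = b · parity S x

  𝟙⁺ : Sign → ℚ
  𝟙⁺ Sign.+ = 1ℚ
  𝟙⁺ Sign.- = 0ℚ

  𝟙 : ∀ {n} → List (SignedParity n) → Cube n → ℚ
  𝟙 [] x = 1ℚ
  𝟙 (c ∷ K) x = 𝟙⁺ (⟦ c ⟧ x) * 𝟙 K x

  paritySum : ∀ {n} → List (SignedParity n) → Cube n → ℚ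
  paritySum [] x = 0ℚ
  paritySum (c ∷ T) x = signℚ (⟦ c ⟧ x) + paritySum T x

  deviation : ∀ {n} → List (SignedParity n) → ℚ → Cube n → ℚ
  deviation T c x = coordinateSum x + paritySum T x - c

  E-deviation² : ∀ n (f : Cube n → Sign) c →
    E n (λ x → square (deviation [] (c * signℚ (f x)) x))
      ≡ fromℕ n - (c + c) * E n (λ x → signℚ (f x) * coordinateSum x) + c * c
  E-deviation² n f c = begin
    E n (λ x → square (deviation [] (c * signℚ (f x)) x))
      ≡⟨ E-cong n expand ⟩
    E n (λ x → (square (coordinateSum x) + - (c + c) * g x) + c * c)
      ≡⟨ E-+ n _ _ ⟩
    E n (λ x → square (coordinateSum x) + - (c + c) * g x) + E n (λ _ → c * c)
      ≡⟨ cong₂ _+_ (E-+ n _ _) (E-const n (c * c)) ⟩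
    E n (square ∘ coordinateSum) + E n (λ x → - (c + c) * g x) + c * c
      ≡⟨ cong₂ (λ a b → a + b + c * c) (E-coordinateSum² n) (E-*ˡ n (- (c + c)) g) ⟩
    fromℕ n + - (c + c) * E n g + c * c
      ≡⟨ solve 3 (λ m c e → m :+ (:- (c :+ c)) :* e :+ c :* c := m :- (c :+ c) :* e :+ c :* c)
           refl (fromℕ n) c (E n g) ⟩
    fromℕ n - (c + c) * E n g + c * c ∎
    where
    open ≡-Reasoning
    g : Cube n → ℚ
    g x = signℚ (f x) * coordinateSum x
    polynomial : ∀ l c σ → square (l + 0ℚ - c * σ) ≡ (square l + - (c + c) * (σ * l)) + (c * c) * (σ * σ)
    polynomial = solve 3 (λ l c σ → (l :+ con 0ℚ :- c :* σ) :* (l :+ con 0ℚ :- c :* σ)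
                                    := (l :* l :+ (:- (c :+ c)) :* (σ :* l)) :+ (c :* c) :* (σ :* σ)) refl
    expand : ∀ x → square (deviation [] (c * signℚ (f x)) x)
                   ≡ (square (coordinateSum x) + - (c + c) * g x) + c * c
    expand x = trans (polynomial (coordinateSum x) c (signℚ (f x)))
                     (cong (λ u → (square (coordinateSum x) + - (c + c) * g x) + u)
                           (trans (cong (c * c *_) (signℚ² (f x))) (*-identityʳ (c * c))))

  𝟙-nonNeg : ∀ {n} (K : List (SignedParity n)) x → 0ℚ ≤ 𝟙 K x
  𝟙-nonNeg [] x = nonNegative⁻¹ 1ℚ
  𝟙-nonNeg (c ∷ K) x = *-nonNeg (𝟙⁺-nonNeg (⟦ c ⟧ x)) (𝟙-nonNeg K x)
    where
    𝟙⁺-nonNeg : ∀ s → 0ℚ ≤ 𝟙⁺ s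
    𝟙⁺-nonNeg Sign.+ = nonNegative⁻¹ 1ℚ
    𝟙⁺-nonNeg Sign.- = ≤-refl

  𝟙⁺-select : ∀ s (g : Sign → ℚ) → 𝟙⁺ (Sign.- · s) * g Sign.- + 𝟙⁺ (Sign.+ · s) * g Sign.+ ≡ g s
  𝟙⁺-select Sign.+ g = solve 2 (λ a b → con 0ℚ :* a :+ con 1ℚ :* b := b) refl (g Sign.-) (g Sign.+)
  𝟙⁺-select Sign.- g = solve 2 (λ a b → con 1ℚ :* a :+ con 0ℚ :* b := a) refl (g Sign.-) (g Sign.+)

  substitute : ∀ {n} → SignedParity n → SignedParity (suc n) → SignedParity n
  substitute (P , b) (true ∷ S , c) = S ∆ P , c · b
  substitute (P , b) (false ∷ S , c) = S , c

  ⟦⟧-substitute : ∀ {n} (p : SignedParity n) c x → ⟦ c ⟧ (⟦ p ⟧ x ∷ x) ≡ ⟦ substitute p c ⟧ x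
  ⟦⟧-substitute (P , b) (true ∷ S , c) x = begin
    c · ((b · parity P x) · parity S x)   ≡⟨ cong (c ·_) (Sign.*-assoc b (parity P x) (parity S x)) ⟩
    c · (b · (parity P x · parity S x))   ≡⟨ Sign.*-assoc c b _ ⟨
    (c · b) · (parity P x · parity S x)   ≡⟨ cong ((c · b) ·_) (Sign.*-comm (parity P x) (parity S x)) ⟩
    (c · b) · (parity S x · parity P x)   ≡⟨ cong ((c · b) ·_) (parity-∆ S P x) ⟨
    (c · b) · parity (S ∆ P) x            ∎
    where open ≡-Reasoning
  ⟦⟧-substitute (P , b) (false ∷ S , c) x = refl

  𝟙-substitute : ∀ {n} (p : SignedParity n) K x → 𝟙 K (⟦ p ⟧ x ∷ x) ≡ 𝟙 (map (substitute p) K) x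
  𝟙-substitute p [] x = refl
  𝟙-substitute p (c ∷ K) x = cong₂ (λ s i → 𝟙⁺ s * i) (⟦⟧-substitute p c x) (𝟙-substitute p K x)

  paritySum-substitute : ∀ {n} (p : SignedParity n) T x →
                         paritySum T (⟦ p ⟧ x ∷ x) ≡ paritySum (map (substitute p) T) x
  paritySum-substitute p [] x = refl
  paritySum-substitute p (c ∷ T) x =
    cong₂ (λ s t → signℚ s + t) (⟦⟧-substitute p c x) (paritySum-substitute p T x)

  deviation-substitute : ∀ {n} (p : SignedParity n) T c x →
    deviation T c (⟦ p ⟧ x ∷ x) ≡ deviation (p ∷ map (substitute p) T) c x
  deviation-substitute p T c x = begin
    u + coordinateSum x + paritySum T (⟦ p ⟧ x ∷ x) - c
      ≡⟨ cong (λ t → u + coordinateSum x + t - c) (paritySum-substitute p T x) ⟩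
    u + coordinateSum x + t - c
      ≡⟨ solve 4 (λ u l t c → u :+ l :+ t :- c := l :+ (u :+ t) :- c) refl u (coordinateSum x) t c ⟩
    coordinateSum x + (u + t) - c ∎
    where
    open ≡-Reasoning
    u = signℚ (⟦ p ⟧ x)
    t = paritySum (map (substitute p) T) x

  -- Pivot K (P , b) K′: K is K′ with the constraint b·x₁·χ_P(x) = + inserted, i.e. x₁ = ⟦ P , b ⟧ x.
  data Pivot {n} : List (SignedParity (suc n)) → SignedParity n → List (SignedParity (suc n)) → Set where
    here  : ∀ {P b K} → Pivot ((true ∷ P , b) ∷ K) (P , b) K
    there : ∀ {c K p K′} → Pivot K p K′ → Pivot (c ∷ K) p (c ∷ K′)

  weaken : ∀ {n} → SignedParity n → SignedParity (suc n)
  weaken (S , b) = false ∷ S , b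

  data HeadView {n} : List (SignedParity (suc n)) → Set where
    pivot : ∀ {K} p K′ → Pivot K p K′ → HeadView K
    free  : ∀ K → HeadView (map weaken K)

  headView : ∀ {n} (K : List (SignedParity (suc n))) → HeadView K
  headView [] = free []
  headView ((true ∷ P , b) ∷ K) = pivot (P , b) K here
  headView ((false ∷ S , b) ∷ K) with headView K
  ... | pivot p K′ K⇝p = pivot p ((false ∷ S , b) ∷ K′) (there K⇝p)
  ... | free K₀ = free ((S , b) ∷ K₀)

  length-pivot : ∀ {n K p K′} → Pivot {n} K p K′ → length K ≡ suc (length K′)
  length-pivot here = refl
  length-pivot (there K⇝p) = cong suc (length-pivot K⇝p)

  𝟙-pivot : ∀ {n K p K′} → Pivot {n} K p K′ → ∀ a x → 𝟙 K (a ∷ x) ≡ 𝟙⁺ (a · ⟦ p ⟧ x) * 𝟙 K′ (a ∷ x)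
  𝟙-pivot {K = (_ ∷ P , b) ∷ K} here a x =
    cong (λ s → 𝟙⁺ s * 𝟙 K (a ∷ x)) (x∙yz≈y∙xz b a (parity P x))
  𝟙-pivot {K = c ∷ K} {p} {_ ∷ K′} (there K⇝p) a x =
    trans (cong (𝟙⁺ (⟦ c ⟧ (a ∷ x)) *_) (𝟙-pivot K⇝p a x))
          (solve 3 (λ u v w → u :* (v :* w) := v :* (u :* w)) refl
             (𝟙⁺ (⟦ c ⟧ (a ∷ x))) (𝟙⁺ (a · ⟦ p ⟧ x)) (𝟙 K′ (a ∷ x)))

  E-pivot : ∀ {n K p K′} → Pivot {n} K p K′ → (G : Cube (suc n) → ℚ) →
    E (suc n) (λ y → 𝟙 K y * G y) ≡ ½ * E n (λ x → 𝟙 (map (substitute p) K′) x * G (⟦ p ⟧ x ∷ x))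
  E-pivot {n} {K} {p} {K′} K⇝p G = cong (½ *_) (trans (sym (E-+ n _ _)) (E-cong n pointwise))
    where
    pointwise : ∀ x → 𝟙 K (Sign.- ∷ x) * G (Sign.- ∷ x) + 𝟙 K (Sign.+ ∷ x) * G (Sign.+ ∷ x)
                    ≡ 𝟙 (map (substitute p) K′) x * G (⟦ p ⟧ x ∷ x)
    pointwise x = begin
      𝟙 K (Sign.- ∷ x) * G (Sign.- ∷ x) + 𝟙 K (Sign.+ ∷ x) * G (Sign.+ ∷ x)
        ≡⟨ cong₂ _+_ (restrict Sign.-) (restrict Sign.+) ⟩
      𝟙⁺ (Sign.- · ⟦ p ⟧ x) * F Sign.- + 𝟙⁺ (Sign.+ · ⟦ p ⟧ x) * F Sign.+
        ≡⟨ 𝟙⁺-select (⟦ p ⟧ x) F ⟩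
      𝟙 K′ (⟦ p ⟧ x ∷ x) * G (⟦ p ⟧ x ∷ x)
        ≡⟨ cong (_* G (⟦ p ⟧ x ∷ x)) (𝟙-substitute p K′ x) ⟩
      𝟙 (map (substitute p) K′) x * G (⟦ p ⟧ x ∷ x) ∎
      where
      open ≡-Reasoning
      F : Sign → ℚ
      F a = 𝟙 K′ (a ∷ x) * G (a ∷ x)
      restrict : ∀ a → 𝟙 K (a ∷ x) * G (a ∷ x) ≡ 𝟙⁺ (a · ⟦ p ⟧ x) * F a
      restrict a = trans (cong (_* G (a ∷ x)) (𝟙-pivot K⇝p a x))
                         (*-assoc (𝟙⁺ (a · ⟦ p ⟧ x)) (𝟙 K′ (a ∷ x)) (G (a ∷ x)))

  𝟙-weaken : ∀ {n} (K : List (SignedParity n)) a x → 𝟙 (map weaken K) (a ∷ x) ≡ 𝟙 K x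
  𝟙-weaken [] a x = refl
  𝟙-weaken (c ∷ K) a x = cong (𝟙⁺ (⟦ c ⟧ x) *_) (𝟙-weaken K a x)

  involvingHead avoidingHead : ∀ {n} → List (SignedParity (suc n)) → List (SignedParity n)
  involvingHead [] = []
  involvingHead ((true ∷ S , b) ∷ T) = (S , b) ∷ involvingHead T
  involvingHead ((false ∷ S , b) ∷ T) = involvingHead T
  avoidingHead [] = []
  avoidingHead ((true ∷ S , b) ∷ T) = avoidingHead T
  avoidingHead ((false ∷ S , b) ∷ T) = (S , b) ∷ avoidingHead T

  length-head : ∀ {n} (T : List (SignedParity (suc n))) →
                length T ≡ length (involvingHead T) ℕ.+ length (avoidingHead T)
  length-head [] = refl
  length-head ((true ∷ S , b) ∷ T) = cong suc (length-head T)
  length-head ((false ∷ S , b) ∷ T) =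
    trans (cong suc (length-head T)) (sym (ℕ.+-suc (length (involvingHead T)) (length (avoidingHead T))))

  paritySum-head : ∀ {n} (T : List (SignedParity (suc n))) a x →
    paritySum T (a ∷ x) ≡ signℚ a * paritySum (involvingHead T) x + paritySum (avoidingHead T) x
  paritySum-head [] a x = sym (trans (+-identityʳ _) (*-zeroʳ (signℚ a)))
  paritySum-head ((true ∷ S , b) ∷ T) a x = begin
    signℚ (b · (a · parity S x)) + paritySum T (a ∷ x)
      ≡⟨ cong₂ _+_ (trans (cong signℚ (x∙yz≈y∙xz b a (parity S x))) (signℚ-· a (b · parity S x)))
                   (paritySum-head T a x) ⟩
    σ * u + (σ * t₁ + t₀)
      ≡⟨ solve 4 (λ σ u t₁ t₀ → σ :* u :+ (σ :* t₁ :+ t₀) := σ :* (u :+ t₁) :+ t₀) refl σ u t₁ t₀ ⟩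
    σ * (u + t₁) + t₀ ∎
    where
    open ≡-Reasoning
    σ = signℚ a
    u = signℚ (b · parity S x)
    t₁ = paritySum (involvingHead T) x
    t₀ = paritySum (avoidingHead T) x
  paritySum-head ((false ∷ S , b) ∷ T) a x = begin
    u + paritySum T (a ∷ x)   ≡⟨ cong (u +_) (paritySum-head T a x) ⟩
    u + (σ * t₁ + t₀)
      ≡⟨ solve 4 (λ σ u t₁ t₀ → u :+ (σ :* t₁ :+ t₀) := σ :* t₁ :+ (u :+ t₀)) refl σ u t₁ t₀ ⟩
    σ * t₁ + (u + t₀)         ∎
    where
    open ≡-Reasoning
    σ = signℚ a
    u = signℚ (b · parity S x)
    t₁ = paritySum (involvingHead T) x
    t₀ = paritySum (avoidingHead T) x

  deviation-head : ∀ {n} (T : List (SignedParity (suc n))) c a x →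
    deviation T c (a ∷ x) ≡ signℚ a * (1ℚ + paritySum (involvingHead T) x) + deviation (avoidingHead T) c x
  deviation-head T c a x = begin
    σ + l + paritySum T (a ∷ x) - c   ≡⟨ cong (λ t → σ + l + t - c) (paritySum-head T a x) ⟩
    σ + l + (σ * t₁ + t₀) - c
      ≡⟨ solve 5 (λ σ l t₁ t₀ c → σ :+ l :+ (σ :* t₁ :+ t₀) :- c := σ :* (con 1ℚ :+ t₁) :+ (l :+ t₀ :- c))
           refl σ l t₁ t₀ c ⟩
    σ * (1ℚ + t₁) + (l + t₀ - c)      ∎
    where
    open ≡-Reasoning
    σ = signℚ a
    l = coordinateSum x
    t₁ = paritySum (involvingHead T) x
    t₀ = paritySum (avoidingHead T) x

  1≤square+length : ∀ {n} (U : List (SignedParity n)) x →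
                    1ℚ ≤ square (1ℚ + paritySum U x) + fromℕ (length U)
  1≤square+length [] x = ≤-refl
  1≤square+length (u ∷ U) x = begin
    1ℚ                     ≤⟨ +-monoʳ-≤ 1ℚ (+-mono-≤ (square-nonNeg q) (fromℕ-nonNeg (length U))) ⟩
    1ℚ + (square q + m)    ≡⟨ solve 3 (λ a b c → c :+ (a :+ b) := a :+ (c :+ b)) refl (square q) m 1ℚ ⟩
    square q + (1ℚ + m)    ∎
    where
    open ≤-Reasoning
    q = 1ℚ + paritySum (u ∷ U) x
    m = fromℕ (length U)

  -- E[(L + paritySum T − c)² | A] ≥ n − 2·length K − length T for the subspace A cut out by K,
  -- multiplied through by Pr[A] = E n (𝟙 K), which may be 0.
  VarianceBound : ∀ n → List (SignedParity n) → List (SignedParity n) → ℚ → Set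
  VarianceBound n K T c =
    E n (𝟙 K) * fromℕ n
      ≤ E n (λ x → 𝟙 K x * square (deviation T c x)) + E n (𝟙 K) * fromℕ (2 ℕ.* length K ℕ.+ length T)

  varianceBound-pivot : ∀ {n K p K′} → (∀ K T c → VarianceBound n K T c) →
                        Pivot K p K′ → ∀ T c → VarianceBound (suc n) K T c
  varianceBound-pivot {n} {K} {p} {K′} bound K⇝p T c = begin
    E (suc n) (𝟙 K) * (1ℚ + fromℕ n)    ≡⟨ cong (_* (1ℚ + fromℕ n)) mass ⟩
    (½ * I) * (1ℚ + fromℕ n)             ≤⟨ halve I J (bound K″ T″ c) ⟩
    ½ * J + (½ * I) * fromℕ (suc m)      ≡⟨ cong₂ _+_ moment (cong₂ _*_ mass (cong fromℕ count)) ⟨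
    E (suc n) (λ y → 𝟙 K y * square (deviation T c y))
      + E (suc n) (𝟙 K) * fromℕ (2 ℕ.* length K ℕ.+ length T) ∎
    where
    open ≤-Reasoning
    K″ = map (substitute p) K′
    T″ = p ∷ map (substitute p) T
    I = E n (𝟙 K″)
    J = E n (λ x → 𝟙 K″ x * square (deviation T″ c x))
    m = 2 ℕ.* length K″ ℕ.+ length T″
    mass : E (suc n) (𝟙 K) ≡ ½ * I
    mass = begin-equality
      E (suc n) (𝟙 K)                 ≡⟨ E-cong (suc n) (λ y → *-identityʳ (𝟙 K y)) ⟨
      E (suc n) (λ y → 𝟙 K y * 1ℚ)    ≡⟨ E-pivot K⇝p (λ _ → 1ℚ) ⟩
      ½ * E n (λ x → 𝟙 K″ x * 1ℚ)     ≡⟨ cong (½ *_) (E-cong n (λ x → *-identityʳ (𝟙 K″ x))) ⟩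
      ½ * I                           ∎
    moment : E (suc n) (λ y → 𝟙 K y * square (deviation T c y)) ≡ ½ * J
    moment = trans (E-pivot K⇝p (λ y → square (deviation T c y)))
                   (cong (½ *_) (E-cong n (λ x → cong (λ d → 𝟙 K″ x * square d) (deviation-substitute p T c x))))
    count : 2 ℕ.* length K ℕ.+ length T ≡ suc m
    count rewrite length-pivot K⇝p | length-map (substitute p) K′ | length-map (substitute p) T =
      arith (length K′) (length T)
      where
      arith : ∀ k t → 2 ℕ.* suc k ℕ.+ t ≡ suc (2 ℕ.* k ℕ.+ suc t)
      arith = solve-∀
    halve : ∀ i j {m′ n′} → i * n′ ≤ j + i * m′ → (½ * i) * (1ℚ + n′) ≤ ½ * j + (½ * i) * (1ℚ + m′)
    halve i j {m′} {n′} i*n′≤j+i*m′ = begin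
      (½ * i) * (1ℚ + n′)
        ≡⟨ solve 2 (λ i n → (con ½ :* i) :* (con 1ℚ :+ n) := con ½ :* (i :+ i :* n)) refl i n′ ⟩
      ½ * (i + i * n′)                ≤⟨ *-monoˡ-≤-nonNeg ½ (+-monoʳ-≤ i i*n′≤j+i*m′) ⟩
      ½ * (i + (j + i * m′))
        ≡⟨ solve 3 (λ i j m → con ½ :* (i :+ (j :+ i :* m)) := con ½ :* j :+ (con ½ :* i) :* (con 1ℚ :+ m))
             refl i j m′ ⟩
      ½ * j + (½ * i) * (1ℚ + m′)     ∎

  varianceBound-free : ∀ {n} → (∀ K T c → VarianceBound n K T c) →
                       ∀ K T c → VarianceBound (suc n) (map weaken K) T c
  varianceBound-free {n} bound K T c = begin
    E (suc n) (𝟙 K⁺) * (1ℚ + fromℕ n)     ≡⟨ cong (_* (1ℚ + fromℕ n)) mass ⟩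
    I * (1ℚ + fromℕ n)                    ≤⟨ combine I A B (bound K U₀ c) slack ⟩
    (A + B) + I * (fromℕ m₀ + fromℕ l₁)
      ≡⟨ cong₂ _+_ moment (cong₂ _*_ mass (trans (cong fromℕ count) (fromℕ-+ m₀ l₁))) ⟨
    E (suc n) (λ y → 𝟙 K⁺ y * square (deviation T c y))
      + E (suc n) (𝟙 K⁺) * fromℕ (2 ℕ.* length K⁺ ℕ.+ length T) ∎
    where
    open ≤-Reasoning
    K⁺ = map weaken K
    U₁ = involvingHead T
    U₀ = avoidingHead T
    I = E n (𝟙 K)
    A = E n (λ x → 𝟙 K x * square (deviation U₀ c x))
    B = E n (λ x → 𝟙 K x * square (1ℚ + paritySum U₁ x))
    m₀ = 2 ℕ.* length K ℕ.+ length U₀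
    l₁ = length U₁
    mass : E (suc n) (𝟙 K⁺) ≡ I
    mass = E-suc n (𝟙 K⁺) (λ x → trans (cong₂ _+_ (𝟙-weaken K Sign.- x) (𝟙-weaken K Sign.+ x))
                                       (solve 1 (λ i → i :+ i := (con 1ℚ :+ con 1ℚ) :* i) refl (𝟙 K x)))
    moment : E (suc n) (λ y → 𝟙 K⁺ y * square (deviation T c y)) ≡ A + B
    moment = trans (E-suc n (λ y → 𝟙 K⁺ y * square (deviation T c y)) pointwise) (E-+ n _ _)
      where
      restrict : ∀ a x → 𝟙 K⁺ (a ∷ x) * square (deviation T c (a ∷ x))
                       ≡ 𝟙 K x * square (signℚ a * (1ℚ + paritySum U₁ x) + deviation U₀ c x)
      restrict a x = cong₂ (λ i d → i * square d) (𝟙-weaken K a x) (deviation-head T c a x)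
      parallelogram : ∀ i u v → i * square (- 1ℚ * u + v) + i * square (1ℚ * u + v)
                                ≡ (1ℚ + 1ℚ) * (i * square v + i * square u)
      parallelogram = solve 3 (λ i u v → i :* ((:- con 1ℚ :* u :+ v) :* (:- con 1ℚ :* u :+ v))
                                         :+ i :* ((con 1ℚ :* u :+ v) :* (con 1ℚ :* u :+ v))
                                         := (con 1ℚ :+ con 1ℚ) :* (i :* (v :* v) :+ i :* (u :* u))) refl
      pointwise : ∀ x → 𝟙 K⁺ (Sign.- ∷ x) * square (deviation T c (Sign.- ∷ x))
                          + 𝟙 K⁺ (Sign.+ ∷ x) * square (deviation T c (Sign.+ ∷ x))
                      ≡ (1ℚ + 1ℚ) * (𝟙 K x * square (deviation U₀ c x) + 𝟙 K x * square (1ℚ + paritySum U₁ x))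
      pointwise x = trans (cong₂ _+_ (restrict Sign.- x) (restrict Sign.+ x))
                          (parallelogram (𝟙 K x) (1ℚ + paritySum U₁ x) (deviation U₀ c x))
    slack : I ≤ B + I * fromℕ l₁
    slack = begin
      E n (𝟙 K)                                       ≤⟨ E-mono-≤ n pointwise ⟩
      E n (λ x → 𝟙 K x * square (q x) + fromℕ l₁ * 𝟙 K x)   ≡⟨ E-+ n _ _ ⟩
      B + E n (λ x → fromℕ l₁ * 𝟙 K x)                ≡⟨ cong (B +_) (E-*ˡ n (fromℕ l₁) (𝟙 K)) ⟩
      B + fromℕ l₁ * I                                ≡⟨ cong (B +_) (*-comm (fromℕ l₁) I) ⟩
      B + I * fromℕ l₁                                ∎
      where
      q : Cube n → ℚ
      q x = 1ℚ + paritySum U₁ x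
      pointwise : ∀ x → 𝟙 K x ≤ 𝟙 K x * square (q x) + fromℕ l₁ * 𝟙 K x
      pointwise x = begin
        𝟙 K x                                 ≡⟨ *-identityʳ (𝟙 K x) ⟨
        𝟙 K x * 1ℚ                            ≤⟨ *-monoˡ-≤-nonNeg (𝟙 K x) {{nonNegative (𝟙-nonNeg K x)}}
                                                                  (1≤square+length U₁ x) ⟩
        𝟙 K x * (square (q x) + fromℕ l₁)
          ≡⟨ solve 3 (λ i s l → i :* (s :+ l) := i :* s :+ l :* i) refl (𝟙 K x) (square (q x)) (fromℕ l₁) ⟩
        𝟙 K x * square (q x) + fromℕ l₁ * 𝟙 K x ∎
    count : 2 ℕ.* length K⁺ ℕ.+ length T ≡ m₀ ℕ.+ l₁
    count rewrite length-map weaken K | length-head T = arith (length K) l₁ (length U₀)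
      where
      arith : ∀ k a b → 2 ℕ.* k ℕ.+ (a ℕ.+ b) ≡ (2 ℕ.* k ℕ.+ b) ℕ.+ a
      arith = solve-∀
    combine : ∀ i a b {m l n′} → i * n′ ≤ a + i * m → i ≤ b + i * l → i * (1ℚ + n′) ≤ (a + b) + i * (m + l)
    combine i a b {m} {l} {n′} i*n′≤a+i*m i≤b+i*l = begin
      i * (1ℚ + n′)              ≡⟨ solve 2 (λ i n → i :* (con 1ℚ :+ n) := i :+ i :* n) refl i n′ ⟩
      i + i * n′                 ≤⟨ +-mono-≤ i≤b+i*l i*n′≤a+i*m ⟩
      (b + i * l) + (a + i * m)
        ≡⟨ solve 5 (λ i a b m l → (b :+ i :* l) :+ (a :+ i :* m) := (a :+ b) :+ i :* (m :+ l))
             refl i a b m l ⟩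
      (a + b) + i * (m + l)      ∎

  varianceBound : ∀ n K T c → VarianceBound n K T c
  varianceBound zero K T c = begin
    𝟙 K [] * 0ℚ   ≡⟨ *-zeroʳ (𝟙 K []) ⟩
    0ℚ            ≤⟨ +-mono-≤ (*-nonNeg (𝟙-nonNeg K []) (square-nonNeg (deviation T c [])))
                              (*-nonNeg (𝟙-nonNeg K []) (fromℕ-nonNeg (2 ℕ.* length K ℕ.+ length T))) ⟩
    𝟙 K [] * square (deviation T c []) + 𝟙 K [] * fromℕ (2 ℕ.* length K ℕ.+ length T) ∎
    where open ≤-Reasoning
  varianceBound (suc n) K T c with headView K
  ... | pivot p K′ K⇝p = varianceBound-pivot (varianceBound n) K⇝p T c
  ... | free K₀        = varianceBound-free (varianceBound n) K₀ T c

  𝟙-split : ∀ {n} S (K : List (SignedParity n)) x → 𝟙 K x ≡ 𝟙 ((S , Sign.-) ∷ K) x + 𝟙 ((S , Sign.+) ∷ K) x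
  𝟙-split S K x with parity S x
  ... | Sign.- = solve 1 (λ i → i := con 1ℚ :* i :+ con 0ℚ :* i) refl (𝟙 K x)
  ... | Sign.+ = solve 1 (λ i → i := con 0ℚ :* i :+ con 1ℚ :* i) refl (𝟙 K x)

  𝟙-node : ∀ {n} S (t₋ t₊ : PDT n) K (h : Sign → ℚ) x →
    𝟙 K x * h (eval (node S t₋ t₊) x)
      ≡ 𝟙 ((S , Sign.-) ∷ K) x * h (eval t₋ x) + 𝟙 ((S , Sign.+) ∷ K) x * h (eval t₊ x)
  𝟙-node S t₋ t₊ K h x with parity S x
  ... | Sign.- = solve 3 (λ i a b → i :* a := con 1ℚ :* i :* a :+ con 0ℚ :* i :* b)
                   refl (𝟙 K x) (h (eval t₋ x)) (h (eval t₊ x))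
  ... | Sign.+ = solve 3 (λ i a b → i :* b := con 0ℚ :* i :* a :+ con 1ℚ :* i :* b)
                   refl (𝟙 K x) (h (eval t₋ x)) (h (eval t₊ x))

  treeBound : ∀ {n} (t : PDT n) K s →
    E n (𝟙 K) * fromℕ n
      ≤ E n (λ x → 𝟙 K x * square (deviation [] (s * signℚ (eval t x)) x))
        + E n (𝟙 K) * fromℕ (2 ℕ.* length K ℕ.+ 2 ℕ.* depth t)
  treeBound (leaf b) K s = varianceBound _ K [] (s * signℚ b)
  treeBound {n} (node S t₋ t₊) K s =
    subst₂ (λ i j → i * fromℕ n ≤ j + i * fromℕ M) (sym mass) (sym moment)
      (add moment₍ K₋ , t₋ ₎ moment₍ K₊ , t₊ ₎ (E-nonNeg n (𝟙-nonNeg K₋)) (E-nonNeg n (𝟙-nonNeg K₊))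
           (fromℕ-mono-≤ (deeper (ℕ.m≤m⊔n (depth t₋) (depth t₊))))
           (fromℕ-mono-≤ (deeper (ℕ.m≤n⊔m (depth t₋) (depth t₊))))
           (treeBound t₋ K₋ s) (treeBound t₊ K₊ s))
    where
    K₋ = (S , Sign.-) ∷ K
    K₊ = (S , Sign.+) ∷ K
    M = 2 ℕ.* length K ℕ.+ 2 ℕ.* depth (node S t₋ t₊)
    moment₍_,_₎ : List (SignedParity n) → PDT n → ℚ
    moment₍ L , u ₎ = E n (λ x → 𝟙 L x * square (deviation [] (s * signℚ (eval u x)) x))
    mass : E n (𝟙 K) ≡ E n (𝟙 K₋) + E n (𝟙 K₊)
    mass = trans (E-cong n (𝟙-split S K)) (E-+ n _ _)
    moment : moment₍ K , node S t₋ t₊ ₎ ≡ moment₍ K₋ , t₋ ₎ + moment₍ K₊ , t₊ ₎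
    moment = trans (E-cong n (λ x → 𝟙-node S t₋ t₊ K (λ b → square (deviation [] (s * signℚ b) x)) x))
                   (E-+ n _ _)
    deeper : ∀ {d} → d ℕ.≤ depth t₋ ⊔ depth t₊ → 2 ℕ.* suc (length K) ℕ.+ 2 ℕ.* d ℕ.≤ M
    deeper {d} d≤ = ℕ.≤-trans (ℕ.≤-reflexive (shift (length K) d))
                              (ℕ.+-monoʳ-≤ (2 ℕ.* length K) (ℕ.*-monoʳ-≤ 2 (ℕ.s≤s d≤)))
      where
      shift : ∀ k d → 2 ℕ.* suc k ℕ.+ 2 ℕ.* d ≡ 2 ℕ.* k ℕ.+ 2 ℕ.* suc d
      shift = solve-∀
    add : ∀ {n′ i₋ i₊ m₋ m₊ m} j₋ j₊ → 0ℚ ≤ i₋ → 0ℚ ≤ i₊ → m₋ ≤ m → m₊ ≤ m →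
          i₋ * n′ ≤ j₋ + i₋ * m₋ → i₊ * n′ ≤ j₊ + i₊ * m₊ → (i₋ + i₊) * n′ ≤ (j₋ + j₊) + (i₋ + i₊) * m
    add {n′} {i₋} {i₊} {m₋} {m₊} {m} j₋ j₊ 0≤i₋ 0≤i₊ m₋≤m m₊≤m bound₋ bound₊ = begin
      (i₋ + i₊) * n′                    ≡⟨ *-distribʳ-+ n′ i₋ i₊ ⟩
      i₋ * n′ + i₊ * n′                 ≤⟨ +-mono-≤ bound₋ bound₊ ⟩
      (j₋ + i₋ * m₋) + (j₊ + i₊ * m₊)   ≤⟨ +-mono-≤ (+-monoʳ-≤ j₋ (*-monoˡ-≤-nonNeg i₋ {{nonNegative 0≤i₋}} m₋≤m))
                                                    (+-monoʳ-≤ j₊ (*-monoˡ-≤-nonNeg i₊ {{nonNegative 0≤i₊}} m₊≤m)) ⟩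
      (j₋ + i₋ * m) + (j₊ + i₊ * m)
        ≡⟨ solve 5 (λ a b i j m → (a :+ i :* m) :+ (b :+ j :* m) := (a :+ b) :+ (i :+ j) :* m)
             refl j₋ j₊ i₋ i₊ m ⟩
      (j₋ + j₊) + (i₋ + i₊) * m         ∎
      where open ≤-Reasoning

  treeBound-cube : ∀ {n} (t : PDT n) s →
    fromℕ n ≤ E n (λ x → square (deviation [] (s * signℚ (eval t x)) x)) + fromℕ (2 ℕ.* depth t)
  treeBound-cube {n} t s = begin
    fromℕ n                                                    ≡⟨ whole (fromℕ n) ⟨
    E n (𝟙 []) * fromℕ n                                       ≤⟨ treeBound t [] s ⟩
    E n (λ x → 1ℚ * F x) + E n (𝟙 []) * fromℕ (2 ℕ.* depth t)
      ≡⟨ cong₂ _+_ (E-cong n (λ x → *-identityˡ (F x))) (whole (fromℕ (2 ℕ.* depth t))) ⟩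
    E n F + fromℕ (2 ℕ.* depth t)                              ∎
    where
    open ≤-Reasoning
    F : Cube n → ℚ
    F x = square (deviation [] (s * signℚ (eval t x)) x)
    whole : ∀ q → E n (𝟙 []) * q ≡ q
    whole q = trans (cong (_* q) (E-const n 1ℚ)) (*-identityˡ q)

  square-sumFin-fourier1≤2*depth : ∀ {n} (t : PDT n) (f : Cube n → Sign) → Computes t f →
                                   square (sumFin n (fourier1 f)) ≤ fromℕ (2 ℕ.* depth t)
  square-sumFin-fourier1≤2*depth {n} t f computes = cancel (begin
    fromℕ n
      ≤⟨ treeBound-cube t s ⟩
    E n (λ x → square (deviation [] (s * signℚ (eval t x)) x)) + r
      ≡⟨ cong (_+ r) (E-cong n (λ x → cong (λ b → square (deviation [] (s * signℚ b) x)) (computes x))) ⟩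
    E n (λ x → square (deviation [] (s * signℚ (f x)) x)) + r
      ≡⟨ cong (_+ r) (E-deviation² n f s) ⟩
    fromℕ n - (s + s) * E n (λ x → signℚ (f x) * coordinateSum x) + s * s + r
      ≡⟨ cong (λ e → fromℕ n - (s + s) * e + s * s + r) (sumFin-fourier1 n f) ⟨
    fromℕ n - (s + s) * s + s * s + r
      ≡⟨ solve 3 (λ m s r → m :- (s :+ s) :* s :+ s :* s :+ r := m :- s :* s :+ r) refl (fromℕ n) s r ⟩
    fromℕ n - s * s + r ∎)
    where
    open ≤-Reasoning
    s = sumFin n (fourier1 f)
    r = fromℕ (2 ℕ.* depth t)
    cancel : ∀ {p q r} → p ≤ p - q + r → q ≤ r
    cancel {p} {q} {r} p≤p-q+r = begin
      q                     ≡⟨ solve 2 (λ p q → q := p :+ (q :- p)) refl p q ⟩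
      p + (q - p)           ≤⟨ +-monoˡ-≤ (q - p) p≤p-q+r ⟩
      p - q + r + (q - p)   ≡⟨ solve 3 (λ p q r → p :- q :+ r :+ (q :- p) := r) refl p q r ⟩
      r                     ∎

open Development

open import Data.Nat using (ℕ; _*_)
open import Data.Sign using (Sign)
open import Data.Sum using (_⊎_; inj₂)
open import Data.Product using (Σ; _×_; _,_)
open import Data.Integer using (+_)
open import Relation.Binary.PropositionalEquality using (_≡_; refl; subst)
open import Data.Rational using (_≤_; 0ℚ; _/_) renaming (_*_ to _*ℚ_)

-- Only the right disjunct is ever needed: s² ≤ 2d holds whatever the sign of s.
theorem8 : (n d : ℕ) (f : Cube n → Sign) →
    Σ (PDT n) (λ t → Computes t f × depth t ≡ d) →
    sumFin n (fourier1 f) ≤ 0ℚ ⊎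
    sumFin n (fourier1 f) *ℚ sumFin n (fourier1 f) ≤ (+ (2 * d)) / 1
theorem8 n d f (t , computes , refl) =
  inj₂ (subst (sumFin n (fourier1 f) *ℚ sumFin n (fourier1 f) ≤_)
              (fromℕ≡/1 (2 * depth t))
              (square-sumFin-fourier1≤2*depth t f computes))
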